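{- $\vdash x\oplus y=x\oplus z\to y=z$.
   Context: PRA (Primitive Recursive Arithmetic) is the quantifier-free formal system whose symbols are variables, PR function symbols, $=$, $\neg$, $\vee$; formulas are built from equations by $\neg,\vee$, with $\wedge,\to,\leftrightarrow$ the usual abbreviations. A function symbol is defined by primitive recursion by $f(\vec x,0)=a$, $f(\vec x,Sy)=b_z(f(\vec x,y))$; PR function symbols are those obtainable from $0$ and $S$ by finitely many such definitions. Axioms: defining equations; $\neg\,Sx=0$; $Sx=Sy\to x=y$; $x=x$; $x=y\to y=x$; $x=y\wedge A_x(x)\to A_x(y)$; propositional axioms $A\vee A\to A$, $A\to A\vee B$, $A\vee B\to B\vee A$, $(B\to C)\to(A\vee B\to A\vee C)$. Rules: instance, modus ponens, induction. $\vdash$ denotes provability in PRA. Symbols: $x+0=x$, $x+Sy=S(x+y)$; $P0=0$, $PSx=x$; $x-0=x$, $x-Sy=P(x-y)$; $C(0,y,z)=y$, $C(Sx,y,z)=z$; $\mathrm{Eq}(x,y)=(x-y)+(y-x)$; $x\mathrel{\dot=}y=C(\mathrm{Eq}(x,y),0,S0)$, $\dot\neg x=C(x,S0,0)$, $x\mathbin{\dot\vee}y=C(x,0,C(y,0,S0))$, $\chi A$ replaces $=,\neg,\vee$ by these. $x\cdot0=0$, $x\cdot Sy=x+x\cdot y$; $x\uparrow0=S0$, $x\uparrow Sy=x\cdot(x\uparrow y)$; $1=S0$, $2=SS0$; $x\le y$ abbreviates $x-y=0$, $x<y$ abbreviates $x\le y\wedge x\ne y$. For a formula $B$ in variable $q$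 with other variables $\vec y$: $\mu_B(\vec y,0)=C(\chi[B_q(0)],0,S0)$, $\mu_B(\vec y,Sq)=C(\chi[\mu_B(\vec y,q)\le q],\mu_B(\vec y,q),C(\chi[B_q(Sq)],Sq,SSq))$; $\exists q{\le}b\,B$ abbreviates $B_q(\mu_B(\vec y,b))$. "$q$ is a power of two" abbreviates $\exists x{\le}q[2\uparrow x=q]$. $Qx$ abbreviates $\mu_B(x,Sx)$ where $B$ is "$q$ is a power of two $\wedge\ q\le Sx\wedge Sx<2\cdot q$"; it satisfies $\vdash Qx=q\leftrightarrow B$. $Rx=Sx-Qx$. $x\oplus y=P(Sx\cdot Qy+Ry)$. -}

module Defs where

open import Data.Nat using (ℕ; zero; suc; _≡ᵇ_)
open import Data.Fin using (Fin; #_; toℕ) renaming (zero to fz; suc to fs)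
open import Data.Vec using (Vec; []; _∷_; _∷ʳ_; tabulate)
open import Data.Bool using (if_then_else_)

-- Fn n : PR function symbols of arity n.
-- frec a b : the symbol f of arity (suc n) defined by
--   f(x⃗,0)  = a         where a has variables x⃗ (var i = x_i)
--   f(x⃗,Sy) = b_z(f(x⃗,y)) where b has variables
--        var 0 = z, var 1 = y, var (2+i) = x_i.
mutual
  data Fn : ℕ → Set where
    fzero : Fn 0
    fsucc : Fn 1
    frec  : ∀ {n} → Tm (Fin n) → Tm (Fin (suc (suc n))) → Fn (suc n)

  data Tm (V : Set) : Set where
    var : V → Tm V
    app : ∀ {m} → Fn m → Vec (Tm V) m → Tm V

mutual
  substT : ∀ {V W : Set} → (V → Tm W) → Tm V → Tm W
  substT σ (var v)    = σ v
  substT σ (app f ts) = app f (substTs σ ts)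

  substTs : ∀ {V W : Set} {m} → (V → Tm W) → Vec (Tm V) m → Vec (Tm W) m
  substTs σ []       = []
  substTs σ (t ∷ ts) = substT σ t ∷ substTs σ ts

infix  6 _≐_
infixr 4 _∨'_
infixr 4 _∧'_
infixr 3 _⇒_

data Fm (V : Set) : Set where
  _≐_  : Tm V → Tm V → Fm V
  ¬'_  : Fm V → Fm V
  _∨'_ : Fm V → Fm V → Fm V

_∧'_ : ∀ {V} → Fm V → Fm V → Fm V
A ∧' B = ¬' (¬' A ∨' ¬' B)

_⇒_ : ∀ {V} → Fm V → Fm V → Fm V
A ⇒ B = ¬' A ∨' B

_⇔_ : ∀ {V} → Fm V → Fm V → Fm V
A ⇔ B = (A ⇒ B) ∧' (B ⇒ A)

_≠_ : ∀ {V} → Tm V → Tm V → Fm V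
t ≠ u = ¬' (t ≐ u)

substF : ∀ {V W : Set} → (V → Tm W) → Fm V → Fm W
substF σ (t ≐ u)  = substT σ t ≐ substT σ u
substF σ (¬' A)   = ¬' substF σ A
substF σ (A ∨' B) = substF σ A ∨' substF σ B

sub1 : ℕ → Tm ℕ → ℕ → Tm ℕ
sub1 x t v = if v ≡ᵇ x then t else var v

_[_≔_] : Fm ℕ → ℕ → Tm ℕ → Fm ℕ
A [ x ≔ t ] = substF (sub1 x t) A

Z : ∀ {V} → Tm V
Z = app fzero []

S : ∀ {V} → Tm V → Tm V
S t = app fsucc (t ∷ [])

-- Defining equations of a symbol frec a b, in the variables 0,1,2,...
-- (x_i = variable i, y = variable n)

xs : (n : ℕ) → Vec (Tm ℕ) n
xs n = tabulate (λ i → var (toℕ i))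

defEq0 : ∀ {n} → Tm (Fin n) → Tm (Fin (suc (suc n))) → Fm ℕ
defEq0 {n} a b =
  app (frec a b) (xs n ∷ʳ Z) ≐ substT (λ i → var (toℕ i)) a

defEqS : ∀ {n} → Tm (Fin n) → Tm (Fin (suc (suc n))) → Fm ℕ
defEqS {n} a b =
  app (frec a b) (xs n ∷ʳ S (var n)) ≐ substT σ b
  where
  σ : Fin (suc (suc n)) → Tm ℕ
  σ fz      = app (frec a b) (xs n ∷ʳ var n)
  σ (fs fz) = var n
  σ (fs (fs i)) = var (toℕ i)

infix 1 ⊢_

data ⊢_ : Fm ℕ → Set where
  ax-def0  : ∀ {n} (a : Tm (Fin n)) (b : Tm (Fin (suc (suc n)))) → ⊢ defEq0 a b
  ax-defS  : ∀ {n} (a : Tm (Fin n)) (b : Tm (Fin (suc (suc n)))) → ⊢ defEqS a b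
  ax-S≠0   : ⊢ ¬' (S (var 0) ≐ Z)
  ax-Sinj  : ⊢ S (var 0) ≐ S (var 1) ⇒ var 0 ≐ var 1
  ax-refl  : ⊢ var 0 ≐ var 0
  ax-sym   : ⊢ var 0 ≐ var 1 ⇒ var 1 ≐ var 0
  ax-leib  : (x y : ℕ) (A : Fm ℕ) → ⊢ (var x ≐ var y ∧' A) ⇒ A [ x ≔ var y ]
  ax-contr : (A : Fm ℕ) → ⊢ (A ∨' A) ⇒ A
  ax-weak  : (A B : Fm ℕ) → ⊢ A ⇒ (A ∨' B)
  ax-perm  : (A B : Fm ℕ) → ⊢ (A ∨' B) ⇒ (B ∨' A)
  ax-assoc : (A B C : Fm ℕ) → ⊢ (B ⇒ C) ⇒ ((A ∨' B) ⇒ (A ∨' C))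
  r-inst   : ∀ {A} (σ : ℕ → Tm ℕ) → ⊢ A → ⊢ substF σ A
  r-mp     : ∀ {A B} → ⊢ A → ⊢ A ⇒ B → ⊢ B
  r-ind    : ∀ {A} (x : ℕ) → ⊢ A [ x ≔ Z ] → ⊢ A ⇒ A [ x ≔ S (var x) ] → ⊢ A

module _ {V : Set} where

  plusF : Fn 2          -- x+0 = x, x+Sy = S(x+y)
  plusF = frec (var (# 0)) (S (var (# 0)))

  _⊹_ : Tm V → Tm V → Tm V
  t ⊹ u = app plusF (t ∷ u ∷ [])

  predF : Fn 1          -- P0 = 0, PSx = x
  predF = frec Z (var (# 1))

  P : Tm V → Tm V
  P t = app predF (t ∷ [])

  monusF : Fn 2         -- x-0 = x, x-Sy = P(x-y)
  monusF = frec (var (# 0)) (app predF (var (# 0) ∷ []))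

  _∸'_ : Tm V → Tm V → Tm V
  t ∸' u = app monusF (t ∷ u ∷ [])

  -- C is defined by recursion on its first argument; in the schema (recursion
  -- on the last argument) it is the symbol C' with C(x,y,z) := C'(y,z,x):
  -- C'(y,z,0) = y, C'(y,z,Sx) = z.
  condF : Fn 3
  condF = frec (var (# 0)) (var (# 3))

  C : Tm V → Tm V → Tm V → Tm V
  C t u w = app condF (u ∷ w ∷ t ∷ [])

  Eq : Tm V → Tm V → Tm V
  Eq t u = (t ∸' u) ⊹ (u ∸' t)

  _=̇_ : Tm V → Tm V → Tm V
  t =̇ u = C (Eq t u) Z (S Z)

  ¬̇ : Tm V → Tm V
  ¬̇ t = C t (S Z) Z

  _∨̇_ : Tm V → Tm V → Tm V
  t ∨̇ u = C t Z (C u Z (S Z))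

  χ : Fm V → Tm V
  χ (t ≐ u)  = t =̇ u
  χ (¬' A)   = ¬̇ (χ A)
  χ (A ∨' B) = χ A ∨̇ χ B

  timesF : Fn 2         -- x·0 = 0, x·Sy = x + x·y
  timesF = frec Z (app plusF (var (# 2) ∷ var (# 0) ∷ []))

  _·_ : Tm V → Tm V → Tm V
  t · u = app timesF (t ∷ u ∷ [])

  expF : Fn 2           -- x↑0 = 1, x↑Sy = x·(x↑y)
  expF = frec (S Z) (app timesF (var (# 2) ∷ var (# 0) ∷ []))

  _↑_ : Tm V → Tm V → Tm V
  t ↑ u = app expF (t ∷ u ∷ [])

  one two : Tm V
  one = S Z
  two = S (S Z)

  _≤'_ : Tm V → Tm V → Fm V
  t ≤' u = (t ∸' u) ≐ Z

  _<'_ : Tm V → Tm V → Fm V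
  t <' u = (t ≤' u) ∧' (t ≠ u)

-- μ_B for a formula B : Fm (Fin (suc n)) where var 0 is the variable q and
-- var (1+i) is the other variable y_i.  μ_B(y⃗,q) is the symbol of arity suc n:
--   μ_B(y⃗,0)  = C(χ[B_q(0)],0,S0)
--   μ_B(y⃗,Sq) = C(χ[μ_B(y⃗,q) ≤ q], μ_B(y⃗,q), C(χ[B_q(Sq)],Sq,SSq))
muF : ∀ {n} → Fm (Fin (suc n)) → Fn (suc n)
muF {n} B = frec a b
  where
  σ0 : Fin (suc n) → Tm (Fin n)
  σ0 fz     = Z
  σ0 (fs i) = var i
  a : Tm (Fin n)
  a = C (χ (substF σ0 B)) Z (S Z)
  -- in b: var 0 = z = μ_B(y⃗,q), var 1 = q, var (2+i) = y_i
  σS : Fin (suc n) → Tm (Fin (suc (suc n)))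
  σS fz     = S (var (fs fz))
  σS (fs i) = var (fs (fs i))
  b : Tm (Fin (suc (suc n)))
  b = C (χ (var fz ≤' var (fs fz))) (var fz)
        (C (χ (substF σS B)) (S (var (fs fz))) (S (S (var (fs fz)))))

-- ∃q≤t B  abbreviates  B_q(μ_B(y⃗,t))   (ys = the other variables y⃗)
existsLe : ∀ {n} {W : Set} → Fm (Fin (suc n)) → Vec (Tm W) n → Tm W → Fm W
existsLe {n} B ys t = substF σ B
  where
  lk : ∀ {m} → Vec (Tm _) m → Fin m → Tm _
  lk (u ∷ us) fz     = u
  lk (u ∷ us) (fs i) = lk us i
  σ : Fin (suc n) → Tm _
  σ fz     = app (muF B) (ys ∷ʳ t)
  σ (fs i) = lk ys i

-- "q is a power of two" := ∃x≤q [2↑x = q]   (bound x = var 0, q = var 1)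
isPow2 : ∀ {W : Set} → Tm W → Fm W
isPow2 q = existsLe (two ↑ var (# 0) ≐ var (# 1)) (q ∷ []) q

-- B for Q : "q is a power of two ∧ q ≤ Sx ∧ Sx < 2·q"  (q = var 0, x = var 1)
BQ : Fm (Fin 2)
BQ = isPow2 (var (# 0)) ∧' (var (# 0) ≤' S (var (# 1))) ∧' (S (var (# 1)) <' (two · var (# 0)))

Q : ∀ {W : Set} → Tm W → Tm W
Q t = app (muF BQ) (t ∷ S t ∷ [])

R : ∀ {W : Set} → Tm W → Tm W
R t = S t ∸' Q t

_⊕_ : ∀ {W : Set} → Tm W → Tm W → Tm W
t ⊕ u = P ((S t · Q u) ⊹ R u)

-- Q y is the power of two with Q y ≤ S y < 2 · Q y, and R y = S y ∸ Q y < Q y, so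
-- S (x ⊕ y) = S x · Q y + R y is a positional representation with block size Q y.
-- If Q y < Q z then 2 · Q y ≤ Q z (compare exponents), hence
-- S x · Q y + R y < S x · (Q y + Q y) ≤ S x · Q z; so x ⊕ y = x ⊕ z forces
-- Q y = Q z, then R y = R z by cancellation, and S y = Q y + R y = S z.
-- That Q y meets its specification follows from the invariant of bounded
-- minimisation, applied to the witness 2 ↑ ⌊log₂ S y⌋ of a primitive recursive
-- logarithm.

module Submission where

open import Defs
open import Data.Bool using (T)
open import Data.Fin using (Fin; toℕ) renaming (zero to fz; suc to fs)
open import Data.List using (List; []; _∷_; _++_)
open import Data.List.Membership.Propositional using (_∈_)
open import Data.List.Relation.Binary.Subset.Propositional using (_⊆_)
open import Data.List.Relation.Binary.Permutation.Propositional.Properties using (∈-resp-↭; shift)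
open import Data.List.Relation.Unary.Any using (here; there)
open import Data.Maybe using (Maybe; just; nothing; is-just)
import Data.Maybe as Maybe
open import Data.Nat using (ℕ; zero; suc; _≟_)
open import Data.Vec using (Vec; []; _∷_)
open import Function using (_∘_; id)
open import Relation.Binary.PropositionalEquality using (_≡_; refl; sym; cong; cong₂; trans; subst; subst₂)
open import Relation.Nullary using (yes; no)

private variable
  φ ψ θ ω : Fm ℕ

-- Propositional logic

⊥′ : Fm ℕ
⊥′ = ¬' (Z ≐ Z)

⇒-trans : ⊢ φ ⇒ ψ → ⊢ ψ ⇒ θ → ⊢ φ ⇒ θ
⇒-trans {φ} {ψ} {θ} p q = r-mp p (r-mp q (ax-assoc (¬' φ) ψ θ))

∨-monoʳ : ⊢ ψ ⇒ θ → ⊢ φ ∨' ψ ⇒ φ ∨' θ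
∨-monoʳ {ψ} {θ} {φ} q = r-mp q (ax-assoc φ ψ θ)

∨-monoˡ : ⊢ φ ⇒ θ → ⊢ φ ∨' ψ ⇒ θ ∨' ψ
∨-monoˡ {φ} {θ} {ψ} q = ⇒-trans (ax-perm φ ψ) (⇒-trans (∨-monoʳ q) (ax-perm ψ θ))

∨-elim : ⊢ φ ⇒ θ → ⊢ ψ ⇒ θ → ⊢ φ ∨' ψ ⇒ θ
∨-elim {θ = θ} p q = ⇒-trans (∨-monoˡ p) (⇒-trans (∨-monoʳ q) (ax-contr θ))

∨-injˡ : ⊢ φ ⇒ φ ∨' ψ
∨-injˡ {φ} {ψ} = ax-weak φ ψ

∨-injʳ : ⊢ ψ ⇒ φ ∨' ψ
∨-injʳ {ψ} {φ} = ⇒-trans (ax-weak ψ φ) (ax-perm ψ φ)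

∨-assocˡ : ⊢ φ ∨' (ψ ∨' θ) ⇒ (φ ∨' ψ) ∨' θ
∨-assocˡ = ∨-elim (⇒-trans ∨-injˡ ∨-injˡ) (∨-elim (⇒-trans ∨-injʳ ∨-injˡ) ∨-injʳ)

⇒-refl : ⊢ φ ⇒ φ
⇒-refl {φ} = r-mp (ax-weak φ φ) (∨-monoʳ (ax-contr φ))

¬¬-intro : ⊢ φ ⇒ ¬' ¬' φ
¬¬-intro {φ} = r-mp (⇒-refl {¬' φ}) (ax-perm (¬' ¬' φ) (¬' φ))

⊥′-elim : ⊢ ⊥′ ⇒ φ
⊥′-elim {φ} = r-mp (r-mp (r-inst (λ _ → Z) ax-refl) ¬¬-intro) (ax-weak (¬' ¬' (Z ≐ Z)) φ)

-- Propositional schemata: formulas of propositional logic whose atoms are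
-- instantiated by PRA formulas.

infixr 4 _∨ₛ_ _∧ₛ_
infixr 3 _⇒ₛ_

data Schema : Set where
  atom  : ℕ → Schema
  neg   : Schema → Schema
  _∨ₛ_ : Schema → Schema → Schema

_⇒ₛ_ _∧ₛ_ _⇔ₛ_ : Schema → Schema → Schema
s ⇒ₛ s′ = neg s ∨ₛ s′
s ∧ₛ s′ = neg (neg s ∨ₛ neg s′)
s ⇔ₛ s′ = (s ⇒ₛ s′) ∧ₛ (s′ ⇒ₛ s)

module Tautology (ρ : List (Fm ℕ)) where

  private variable
    s : Schema
    i : ℕ
    l k : List Schema

  valuation : List (Fm ℕ) → ℕ → Fm ℕ
  valuation []      _       = ⊥′
  valuation (φ ∷ _) zero    = φ
  valuation (_ ∷ ρ) (suc i) = valuation ρ i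

  ⟦_⟧ : Schema → Fm ℕ
  ⟦ atom i ⟧   = valuation ρ i
  ⟦ neg s ⟧    = ¬' ⟦ s ⟧
  ⟦ s ∨ₛ s′ ⟧ = ⟦ s ⟧ ∨' ⟦ s′ ⟧

  ⋁ : List Schema → Fm ℕ
  ⋁ []      = ⊥′
  ⋁ (s ∷ l) = ⟦ s ⟧ ∨' ⋁ l

  ∈⇒⋁ : s ∈ l → ⊢ ⟦ s ⟧ ⇒ ⋁ l
  ∈⇒⋁ (here refl) = ∨-injˡ
  ∈⇒⋁ (there s∈l) = ⇒-trans (∈⇒⋁ s∈l) ∨-injʳ

  ⊥′⇒⋁ : ∀ l → ⊢ ⊥′ ⇒ ⋁ l
  ⊥′⇒⋁ []      = ⇒-refl
  ⊥′⇒⋁ (_ ∷ l) = ⇒-trans (⊥′⇒⋁ l) ∨-injʳ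

  ⊆⇒⋁ : l ⊆ k → ⊢ ⋁ l ⇒ ⋁ k
  ⊆⇒⋁ {[]}    {k} _   = ⊥′⇒⋁ k
  ⊆⇒⋁ {_ ∷ l} l⊆k = ∨-elim (∈⇒⋁ (l⊆k (here refl))) (⊆⇒⋁ (l⊆k ∘ there))

  weaken : l ⊆ k → ⊢ ⋁ l → ⊢ ⋁ k
  weaken l⊆k p = r-mp p (⊆⇒⋁ l⊆k)

  complementary : atom i ∈ l → neg (atom i) ∈ l → ⊢ ⋁ l
  complementary {i} a∈l ¬a∈l = weaken pair⊆l (r-mp ⇒-refl (∨-monoʳ ∨-injˡ))
    where
    pair⊆l : neg (atom i) ∷ atom i ∷ [] ⊆ _
    pair⊆l (here refl)         = ¬a∈l
    pair⊆l (there (here refl)) = a∈l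

  find-neg-atom : ∀ i l → Maybe (neg (atom i) ∈ l)
  find-neg-atom i []                 = nothing
  find-neg-atom i (neg (atom j) ∷ l) with i ≟ j
  ... | yes refl = just (here refl)
  ... | no _     = Maybe.map there (find-neg-atom i l)
  find-neg-atom i (_ ∷ l)            = Maybe.map there (find-neg-atom i l)

  find-contradiction : ∀ lits → lits ⊆ l → Maybe (⊢ ⋁ l)
  find-contradiction []             _ = nothing
  find-contradiction (atom i ∷ lits) ⊆l with find-neg-atom i _
  ... | just ¬a∈l = just (complementary (⊆l (here refl)) ¬a∈l)
  ... | nothing   = find-contradiction lits (⊆l ∘ there)
  find-contradiction (_ ∷ lits)     ⊆l = find-contradiction lits (⊆l ∘ there)

  move-to-front : ∀ todo {lits} → todo ++ s ∷ lits ⊆ s ∷ todo ++ lits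
  move-to-front {s} todo {lits} = ∈-resp-↭ (shift s todo lits)

  -- Proof search in a one-sided sequent calculus: a sequent is a disjunction
  -- of schemata, and a branch closes on a complementary pair of literals.
  search : ℕ → (todo lits : List Schema) → Maybe (⊢ ⋁ (todo ++ lits))
  search zero    _                         _    = nothing
  search (suc n) []                        lits = find-contradiction lits id
  search (suc n) (atom i ∷ todo)           lits =
    Maybe.map (weaken (move-to-front todo)) (search n todo (atom i ∷ lits))
  search (suc n) (neg (atom i) ∷ todo)     lits =
    Maybe.map (weaken (move-to-front todo)) (search n todo (neg (atom i) ∷ lits))
  search (suc n) (neg (neg s) ∷ todo)      lits =
    Maybe.map (λ p → r-mp p (∨-monoˡ ¬¬-intro)) (search n (s ∷ todo) lits)
  search (suc n) ((s ∨ₛ s′) ∷ todo)       lits =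
    Maybe.map (λ p → r-mp p ∨-assocˡ) (search n (s ∷ s′ ∷ todo) lits)
  search (suc n) (neg (s ∨ₛ s′) ∷ todo)   lits
    with search n (neg s ∷ todo) lits | search n (neg s′ ∷ todo) lits
  ... | just p | just q = just (∨-elim p q)
  ... | _      | _      = nothing

  tautology : (s : Schema) → {T (is-just (search 200 (s ∷ []) []))} → ⊢ ⟦ s ⟧
  tautology s {found} = r-mp (extract (search 200 (s ∷ []) []) found) (∨-elim ⇒-refl ⊥′-elim)
    where
    extract : ∀ {X : Set} (m : Maybe X) → T (is-just m) → X
    extract (just x) _ = x

open Tautology using (tautology)

⇒-const : ⊢ φ ⇒ ψ ⇒ φ
⇒-const {φ} {ψ} = tautology (φ ∷ ψ ∷ []) (atom 0 ⇒ₛ atom 1 ⇒ₛ atom 0)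

-- Natural deduction: Γ ⊩ φ is ⊢ γₙ ⇒ … ⇒ γ₁ ⇒ φ for Γ = γ₁ ∷ … ∷ γₙ.

infix 1 _⊩_

⇒-chain : List (Fm ℕ) → Fm ℕ → Fm ℕ
⇒-chain []      φ = φ
⇒-chain (γ ∷ Γ) φ = ⇒-chain Γ (γ ⇒ φ)

-- A record rather than a synonym, so that Γ and φ are inferable from the type.
record _⊩_ (Γ : List (Fm ℕ)) (φ : Fm ℕ) : Set where
  constructor ⟨_⟩
  field proof : ⊢ ⇒-chain Γ φ
open _⊩_

private variable
  Γ : List (Fm ℕ)

chain-map : ∀ Γ → ⊢ φ ⇒ ψ → ⊢ ⇒-chain Γ φ → ⊢ ⇒-chain Γ ψ
chain-map []      p q = r-mp q p
chain-map {φ} {ψ} (γ ∷ Γ) p q = chain-map Γ (r-mp p compose) q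
  where
  compose : ⊢ (φ ⇒ ψ) ⇒ (γ ⇒ φ) ⇒ (γ ⇒ ψ)
  compose = tautology (φ ∷ ψ ∷ γ ∷ [])
    ((atom 0 ⇒ₛ atom 1) ⇒ₛ (atom 2 ⇒ₛ atom 0) ⇒ₛ atom 2 ⇒ₛ atom 1)

chain-lift : ∀ Γ → ⊢ φ → ⊢ ⇒-chain Γ φ
chain-lift []      p = p
chain-lift (γ ∷ Γ) p = chain-lift Γ (r-mp p ⇒-const)

chain-mp : ∀ Γ → ⊢ ⇒-chain Γ (φ ⇒ ψ) → ⊢ ⇒-chain Γ φ → ⊢ ⇒-chain Γ ψ
chain-mp []      p q = r-mp q p
chain-mp {φ} {ψ} (γ ∷ Γ) p q = chain-mp Γ (chain-map Γ distribute p) q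
  where
  distribute : ⊢ (γ ⇒ φ ⇒ ψ) ⇒ (γ ⇒ φ) ⇒ (γ ⇒ ψ)
  distribute = tautology (γ ∷ φ ∷ ψ ∷ [])
    ((atom 0 ⇒ₛ atom 1 ⇒ₛ atom 2) ⇒ₛ (atom 0 ⇒ₛ atom 1) ⇒ₛ atom 0 ⇒ₛ atom 2)

⊩-lift : ⊢ φ → Γ ⊩ φ
⊩-lift {Γ = Γ} p = ⟨ chain-lift Γ p ⟩

⊩-map : ⊢ φ ⇒ ψ → Γ ⊩ φ → Γ ⊩ ψ
⊩-map {Γ = Γ} p ⟨ q ⟩ = ⟨ chain-map Γ p q ⟩

⊩-mp : Γ ⊩ φ ⇒ ψ → Γ ⊩ φ → Γ ⊩ ψ
⊩-mp {Γ = Γ} ⟨ p ⟩ ⟨ q ⟩ = ⟨ chain-mp Γ p q ⟩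

⊩-map₂ : ⊢ φ ⇒ ψ ⇒ θ → Γ ⊩ φ → Γ ⊩ ψ → Γ ⊩ θ
⊩-map₂ p q r = ⊩-mp (⊩-map p q) r

⊩-map₃ : ⊢ φ ⇒ ψ ⇒ θ ⇒ ω → Γ ⊩ φ → Γ ⊩ ψ → Γ ⊩ θ → Γ ⊩ ω
⊩-map₃ p q r s = ⊩-mp (⊩-map₂ p q r) s

⊩⇒⊢ : [] ⊩ φ → ⊢ φ
⊩⇒⊢ = proof

⊩-intro : φ ∷ Γ ⊩ ψ → Γ ⊩ φ ⇒ ψ
⊩-intro ⟨ p ⟩ = ⟨ p ⟩

⊩-weaken : Γ ⊩ ψ → φ ∷ Γ ⊩ ψ
⊩-weaken {Γ = Γ} ⟨ p ⟩ = ⟨ chain-map Γ ⇒-const p ⟩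

hyp₀ : φ ∷ Γ ⊩ φ
hyp₀ {Γ = Γ} = ⟨ chain-lift Γ ⇒-refl ⟩

hyp₁ : ∀ {φ₀} → φ₀ ∷ φ ∷ Γ ⊩ φ
hyp₁ = ⊩-weaken hyp₀

hyp₂ : ∀ {φ₀ φ₁} → φ₀ ∷ φ₁ ∷ φ ∷ Γ ⊩ φ
hyp₂ = ⊩-weaken hyp₁

hyp₃ : ∀ {φ₀ φ₁ φ₂} → φ₀ ∷ φ₁ ∷ φ₂ ∷ φ ∷ Γ ⊩ φ
hyp₃ = ⊩-weaken hyp₂

hyp₄ : ∀ {φ₀ φ₁ φ₂ φ₃} → φ₀ ∷ φ₁ ∷ φ₂ ∷ φ₃ ∷ φ ∷ Γ ⊩ φ
hyp₄ = ⊩-weaken hyp₃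

∧-intro : Γ ⊩ φ → Γ ⊩ ψ → Γ ⊩ φ ∧' ψ
∧-intro {φ = φ} {ψ = ψ} = ⊩-map₂ (tautology (φ ∷ ψ ∷ []) (atom 0 ⇒ₛ atom 1 ⇒ₛ atom 0 ∧ₛ atom 1))

∧-proj₁ : Γ ⊩ φ ∧' ψ → Γ ⊩ φ
∧-proj₁ {φ = φ} {ψ = ψ} = ⊩-map (tautology (φ ∷ ψ ∷ []) (atom 0 ∧ₛ atom 1 ⇒ₛ atom 0))

∧-proj₂ : Γ ⊩ φ ∧' ψ → Γ ⊩ ψ
∧-proj₂ {φ = φ} {ψ = ψ} = ⊩-map (tautology (φ ∷ ψ ∷ []) (atom 0 ∧ₛ atom 1 ⇒ₛ atom 1))

∨-intro₁ : Γ ⊩ φ → Γ ⊩ φ ∨' ψ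
∨-intro₁ = ⊩-map ∨-injˡ

∨-intro₂ : Γ ⊩ ψ → Γ ⊩ φ ∨' ψ
∨-intro₂ = ⊩-map ∨-injʳ

∨-cases : Γ ⊩ φ ∨' ψ → φ ∷ Γ ⊩ θ → ψ ∷ Γ ⊩ θ → Γ ⊩ θ
∨-cases {φ = φ} {ψ = ψ} {θ = θ} p q r = ⊩-map₃ case-split p (⊩-intro q) (⊩-intro r)
  where
  case-split : ⊢ (φ ∨' ψ) ⇒ (φ ⇒ θ) ⇒ (ψ ⇒ θ) ⇒ θ
  case-split = tautology (φ ∷ ψ ∷ θ ∷ [])
    ((atom 0 ∨ₛ atom 1) ⇒ₛ (atom 0 ⇒ₛ atom 2) ⇒ₛ (atom 1 ⇒ₛ atom 2) ⇒ₛ atom 2)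

by-cases : ∀ φ → φ ∷ Γ ⊩ θ → ¬' φ ∷ Γ ⊩ θ → Γ ⊩ θ
by-cases φ = ∨-cases (⊩-lift (r-mp ⇒-refl (ax-perm (¬' φ) φ)))

contradiction : Γ ⊩ φ → Γ ⊩ ¬' φ → Γ ⊩ ψ
contradiction {φ = φ} {ψ = ψ} = ⊩-map₂ (tautology (φ ∷ ψ ∷ []) (atom 0 ⇒ₛ neg (atom 0) ⇒ₛ atom 1))

¬-intro : φ ∷ Γ ⊩ ¬' φ → Γ ⊩ ¬' φ
¬-intro {φ = φ} p = ⊩-map (tautology (φ ∷ []) ((atom 0 ⇒ₛ neg (atom 0)) ⇒ₛ neg (atom 0))) (⊩-intro p)

⇔-to : Γ ⊩ φ ⇔ ψ → Γ ⊩ φ → Γ ⊩ ψ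
⇔-to {φ = φ} {ψ = ψ} = ⊩-map₂ (tautology (φ ∷ ψ ∷ []) ((atom 0 ⇔ₛ atom 1) ⇒ₛ atom 0 ⇒ₛ atom 1))

⇔-from : Γ ⊩ φ ⇔ ψ → Γ ⊩ ψ → Γ ⊩ φ
⇔-from {φ = φ} {ψ = ψ} = ⊩-map₂ (tautology (φ ∷ ψ ∷ []) ((atom 0 ⇔ₛ atom 1) ⇒ₛ atom 1 ⇒ₛ atom 0))

⇔-intro : φ ∷ Γ ⊩ ψ → ψ ∷ Γ ⊩ φ → Γ ⊩ φ ⇔ ψ
⇔-intro {φ = φ} {ψ = ψ} p q = ⊩-map₂
  (tautology (φ ∷ ψ ∷ []) ((atom 0 ⇒ₛ atom 1) ⇒ₛ (atom 1 ⇒ₛ atom 0) ⇒ₛ (atom 0 ⇔ₛ atom 1)))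
  (⊩-intro p) (⊩-intro q)

induction : ∀ φ x → [] ⊩ φ [ x ≔ Z ] → φ ∷ [] ⊩ φ [ x ≔ S (var x) ] → ⊢ φ
induction φ x ⟨ base ⟩ ⟨ step ⟩ = r-ind x base step

-- Substitution

mutual
  substT-∘ : ∀ {U V W : Set} (σ : V → Tm W) (τ : U → Tm V) t →
             substT σ (substT τ t) ≡ substT (substT σ ∘ τ) t
  substT-∘ σ τ (var v)    = refl
  substT-∘ σ τ (app f ts) = cong (app f) (substTs-∘ σ τ ts)

  substTs-∘ : ∀ {U V W : Set} {m} (σ : V → Tm W) (τ : U → Tm V) (ts : Vec (Tm U) m) →
              substTs σ (substTs τ ts) ≡ substTs (substT σ ∘ τ) ts
  substTs-∘ σ τ []       = refl
  substTs-∘ σ τ (t ∷ ts) = cong₂ _∷_ (substT-∘ σ τ t) (substTs-∘ σ τ ts)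

mutual
  substT-cong : ∀ {V W : Set} {σ τ : V → Tm W} → (∀ v → σ v ≡ τ v) → ∀ t → substT σ t ≡ substT τ t
  substT-cong σ≗τ (var v)    = σ≗τ v
  substT-cong σ≗τ (app f ts) = cong (app f) (substTs-cong σ≗τ ts)

  substTs-cong : ∀ {V W : Set} {m} {σ τ : V → Tm W} → (∀ v → σ v ≡ τ v) →
                 (ts : Vec (Tm V) m) → substTs σ ts ≡ substTs τ ts
  substTs-cong σ≗τ []       = refl
  substTs-cong σ≗τ (t ∷ ts) = cong₂ _∷_ (substT-cong σ≗τ t) (substTs-cong σ≗τ ts)

substF-∘ : ∀ {U V W : Set} (σ : V → Tm W) (τ : U → Tm V) φ →
           substF σ (substF τ φ) ≡ substF (substT σ ∘ τ) φ
substF-∘ σ τ (t ≐ u)  = cong₂ _≐_ (substT-∘ σ τ t) (substT-∘ σ τ u)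
substF-∘ σ τ (¬' φ)   = cong ¬'_ (substF-∘ σ τ φ)
substF-∘ σ τ (φ ∨' ψ) = cong₂ _∨'_ (substF-∘ σ τ φ) (substF-∘ σ τ ψ)

substF-cong : ∀ {V W : Set} {σ τ : V → Tm W} → (∀ v → σ v ≡ τ v) → ∀ φ → substF σ φ ≡ substF τ φ
substF-cong σ≗τ (t ≐ u)  = cong₂ _≐_ (substT-cong σ≗τ t) (substT-cong σ≗τ u)
substF-cong σ≗τ (¬' φ)   = cong ¬'_ (substF-cong σ≗τ φ)
substF-cong σ≗τ (φ ∨' ψ) = cong₂ _∨'_ (substF-cong σ≗τ φ) (substF-cong σ≗τ ψ)

χ-substF : ∀ {V W : Set} (σ : V → Tm W) φ → substT σ (χ φ) ≡ χ (substF σ φ)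
χ-substF σ (t ≐ u)  = refl
χ-substF σ (¬' φ)   = cong ¬̇ (χ-substF σ φ)
χ-substF σ (φ ∨' ψ) = cong₂ _∨̇_ (χ-substF σ φ) (χ-substF σ ψ)

-- Equality

-- Formulas with a hole: the variable `nothing` marks the hole.

fill : Tm ℕ → Maybe ℕ → Tm ℕ
fill t nothing  = t
fill t (just k) = var k

_⟪_⟫ : Fm (Maybe ℕ) → Tm ℕ → Fm ℕ
φ ⟪ t ⟫ = substF (fill t) φ

private variable
  s t u w d t′ u′ w′ : Tm ℕ

-- Axiom ax-leib for the variables 0 and 1, with the hole sent to 0 and the
-- remaining variables shifted past 1 and back.
leibniz : (φ : Fm (Maybe ℕ)) → ⊢ t ≐ u ∧' φ ⟪ t ⟫ ⇒ φ ⟪ u ⟫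
leibniz {t} {u} φ =
  subst₂ (λ φt φu → ⊢ t ≐ u ∧' φt ⇒ φu) at-t at-u (r-inst σ (ax-leib 0 1 shifted))
  where
  shift-hole : Maybe ℕ → Tm ℕ
  shift-hole nothing  = var 0
  shift-hole (just k) = var (suc (suc k))
  shifted : Fm ℕ
  shifted = substF shift-hole φ
  σ : ℕ → Tm ℕ
  σ zero          = t
  σ (suc zero)    = u
  σ (suc (suc k)) = var k
  at-t : substF σ shifted ≡ φ ⟪ t ⟫
  at-t = trans (substF-∘ σ shift-hole φ) (substF-cong (λ { nothing → refl ; (just k) → refl }) φ)
  at-u : substF σ (shifted [ 0 ≔ var 1 ]) ≡ φ ⟪ u ⟫
  at-u = trans (substF-∘ σ _ shifted)
           (trans (substF-∘ _ shift-hole φ) (substF-cong (λ { nothing → refl ; (just k) → refl }) φ))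

≐-subst : (φ : Fm (Maybe ℕ)) → Γ ⊩ t ≐ u → Γ ⊩ φ ⟪ t ⟫ → Γ ⊩ φ ⟪ u ⟫
≐-subst φ t≐u φt = ⊩-mp (⊩-lift (leibniz φ)) (∧-intro t≐u φt)

arguments : List (Tm ℕ) → ℕ → Tm ℕ
arguments []       k       = var k
arguments (t ∷ ts) zero    = t
arguments (t ∷ ts) (suc k) = arguments ts k

-- Facts about arbitrary terms are proved for variables, where the induction
-- rule applies and substitution computes, and then instantiated.
instantiate : (ts : List (Tm ℕ)) → ⊢ φ → Γ ⊩ substF (arguments ts) φ
instantiate ts p = ⊩-lift (r-inst (arguments ts) p)

x₀ x₁ x₂ x₃ x₄ x₅ : Tm ℕ
x₀ = var 0
x₁ = var 1
x₂ = var 2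
x₃ = var 3
x₄ = var 4
x₅ = var 5

□ : Tm (Maybe ℕ)
□ = var nothing

x̂ : ℕ → Tm (Maybe ℕ)
x̂ k = var (just k)

≐-refl : Γ ⊩ t ≐ t
≐-refl {t = t} = instantiate (t ∷ []) ax-refl

≐-sym : Γ ⊩ t ≐ u → Γ ⊩ u ≐ t
≐-sym {t = t} {u = u} = ⊩-mp (instantiate (t ∷ u ∷ []) ax-sym)

≐-trans : Γ ⊩ t ≐ u → Γ ⊩ u ≐ w → Γ ⊩ t ≐ w
≐-trans {t = t} {u = u} {w = w} t≐u u≐w =
  ⊩-map₂ (r-inst (arguments (t ∷ u ∷ w ∷ [])) closed) (≐-sym t≐u) u≐w
  where
  closed : ⊢ x₁ ≐ x₀ ⇒ x₁ ≐ x₂ ⇒ x₀ ≐ x₂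
  closed = ⊩⇒⊢ (⊩-intro (⊩-intro (≐-subst (□ ≐ x̂ 2) hyp₁ hyp₀)))

infixr 2 _≐⟨_⟩_
infix  3 _∎

_≐⟨_⟩_ : ∀ t → Γ ⊩ t ≐ u → Γ ⊩ u ≐ w → Γ ⊩ t ≐ w
t ≐⟨ t≐u ⟩ u≐w = ≐-trans t≐u u≐w

_∎ : ∀ t → Γ ⊩ t ≐ t
t ∎ = ≐-refl

app-cong₁ : (f : Fn 1) → Γ ⊩ t ≐ u → Γ ⊩ app f (t ∷ []) ≐ app f (u ∷ [])
app-cong₁ {t = t} {u = u} f = ⊩-mp (instantiate (t ∷ u ∷ []) closed)
  where
  closed : ⊢ x₀ ≐ x₁ ⇒ app f (x₀ ∷ []) ≐ app f (x₁ ∷ [])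
  closed = ⊩⇒⊢ (⊩-intro (≐-subst (app f (x̂ 0 ∷ []) ≐ app f (□ ∷ [])) hyp₀ ≐-refl))

app-cong₂ : (f : Fn 2) → Γ ⊩ t ≐ u → Γ ⊩ t′ ≐ u′ → Γ ⊩ app f (t ∷ t′ ∷ []) ≐ app f (u ∷ u′ ∷ [])
app-cong₂ {t = t} {u = u} {t′ = t′} {u′ = u′} f =
  ⊩-map₂ (r-inst (arguments (t ∷ t′ ∷ u ∷ u′ ∷ [])) closed)
  where
  closed : ⊢ x₀ ≐ x₂ ⇒ x₁ ≐ x₃ ⇒ app f (x₀ ∷ x₁ ∷ []) ≐ app f (x₂ ∷ x₃ ∷ [])
  closed = ⊩⇒⊢ (⊩-intro (⊩-intro
    (≐-subst (app f (x̂ 0 ∷ x̂ 1 ∷ []) ≐ app f (x̂ 2 ∷ □ ∷ [])) hyp₀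
      (≐-subst (app f (x̂ 0 ∷ x̂ 1 ∷ []) ≐ app f (□ ∷ x̂ 1 ∷ [])) hyp₁ ≐-refl))))

app-cong₃ : (f : Fn 3) → Γ ⊩ t ≐ u → Γ ⊩ t′ ≐ u′ → Γ ⊩ w ≐ w′ →
            Γ ⊩ app f (t ∷ t′ ∷ w ∷ []) ≐ app f (u ∷ u′ ∷ w′ ∷ [])
app-cong₃ {t = t} {u = u} {t′ = t′} {u′ = u′} {w = w} {w′ = w′} f =
  ⊩-map₃ (r-inst (arguments (t ∷ t′ ∷ w ∷ u ∷ u′ ∷ w′ ∷ [])) closed)
  where
  closed : ⊢ x₀ ≐ x₃ ⇒ x₁ ≐ x₄ ⇒ x₂ ≐ x₅ ⇒
             app f (x₀ ∷ x₁ ∷ x₂ ∷ []) ≐ app f (x₃ ∷ x₄ ∷ x₅ ∷ [])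
  closed = ⊩⇒⊢ (⊩-intro (⊩-intro (⊩-intro
    (≐-subst (app f (x̂ 0 ∷ x̂ 1 ∷ x̂ 2 ∷ []) ≐ app f (x̂ 3 ∷ x̂ 4 ∷ □ ∷ [])) hyp₀
      (≐-subst (app f (x̂ 0 ∷ x̂ 1 ∷ x̂ 2 ∷ []) ≐ app f (x̂ 3 ∷ □ ∷ x̂ 2 ∷ [])) hyp₁
        (≐-subst (app f (x̂ 0 ∷ x̂ 1 ∷ x̂ 2 ∷ []) ≐ app f (□ ∷ x̂ 1 ∷ x̂ 2 ∷ [])) hyp₂ ≐-refl))))))

-- Arithmetic

+-identityʳ : ∀ t → Γ ⊩ t ⊹ Z ≐ t
+-identityʳ t = instantiate (t ∷ []) (ax-def0 _ _)

+-suc : ∀ t u → Γ ⊩ t ⊹ S u ≐ S (t ⊹ u)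
+-suc t u = instantiate (t ∷ u ∷ []) (ax-defS _ _)

P-zero : Γ ⊩ P Z ≐ Z
P-zero = instantiate [] (ax-def0 _ _)

P-suc : ∀ t → Γ ⊩ P (S t) ≐ t
P-suc t = instantiate (t ∷ []) (ax-defS _ _)

∸-identityʳ : ∀ t → Γ ⊩ t ∸' Z ≐ t
∸-identityʳ t = instantiate (t ∷ []) (ax-def0 _ _)

∸-suc : ∀ t u → Γ ⊩ t ∸' S u ≐ P (t ∸' u)
∸-suc t u = instantiate (t ∷ u ∷ []) (ax-defS _ _)

C-zero : ∀ t u → Γ ⊩ C Z t u ≐ t
C-zero t u = instantiate (t ∷ u ∷ []) (ax-def0 _ _)

C-suc : ∀ s t u → Γ ⊩ C (S s) t u ≐ u
C-suc s t u = instantiate (t ∷ u ∷ s ∷ []) (ax-defS _ _)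

·-zero : ∀ t → Γ ⊩ t · Z ≐ Z
·-zero t = instantiate (t ∷ []) (ax-def0 _ _)

·-suc : ∀ t u → Γ ⊩ t · S u ≐ t ⊹ (t · u)
·-suc t u = instantiate (t ∷ u ∷ []) (ax-defS _ _)

↑-zero : ∀ t → Γ ⊩ t ↑ Z ≐ S Z
↑-zero t = instantiate (t ∷ []) (ax-def0 _ _)

↑-suc : ∀ t u → Γ ⊩ t ↑ S u ≐ t · (t ↑ u)
↑-suc t u = instantiate (t ∷ u ∷ []) (ax-defS _ _)

S-cong : Γ ⊩ t ≐ u → Γ ⊩ S t ≐ S u
S-cong = app-cong₁ fsucc

P-cong : Γ ⊩ t ≐ u → Γ ⊩ P t ≐ P u
P-cong = app-cong₁ (predF {ℕ})

⊹-cong : Γ ⊩ t ≐ t′ → Γ ⊩ u ≐ u′ → Γ ⊩ t ⊹ u ≐ t′ ⊹ u′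
⊹-cong = app-cong₂ (plusF {ℕ})

∸-cong : Γ ⊩ t ≐ t′ → Γ ⊩ u ≐ u′ → Γ ⊩ t ∸' u ≐ t′ ∸' u′
∸-cong = app-cong₂ (monusF {ℕ})

·-cong : Γ ⊩ t ≐ t′ → Γ ⊩ u ≐ u′ → Γ ⊩ t · u ≐ t′ · u′
·-cong = app-cong₂ (timesF {ℕ})

↑-cong : Γ ⊩ t ≐ t′ → Γ ⊩ u ≐ u′ → Γ ⊩ t ↑ u ≐ t′ ↑ u′
↑-cong = app-cong₂ (expF {ℕ})

C-cong : ∀ {s′} → Γ ⊩ s ≐ s′ → Γ ⊩ t ≐ t′ → Γ ⊩ u ≐ u′ → Γ ⊩ C s t u ≐ C s′ t′ u′
C-cong s≐s′ t≐t′ u≐u′ = app-cong₃ (condF {ℕ}) t≐t′ u≐u′ s≐s′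

≐-resp : Γ ⊩ t ≐ t′ → Γ ⊩ u ≐ u′ → Γ ⊩ t ≐ u → Γ ⊩ t′ ≐ u′
≐-resp t≐t′ u≐u′ t≐u = ≐-trans (≐-sym t≐t′) (≐-trans t≐u u≐u′)

S-injective : Γ ⊩ S t ≐ S u → Γ ⊩ t ≐ u
S-injective {t = t} {u = u} = ⊩-mp (instantiate (t ∷ u ∷ []) ax-Sinj)

S≢0 : Γ ⊩ S t ≐ Z → Γ ⊩ φ
S≢0 {t = t} St≐0 = contradiction St≐0 (instantiate (t ∷ []) ax-S≠0)

zero-or-suc : ∀ t → Γ ⊩ t ≐ Z ∨' t ≐ S (P t)
zero-or-suc t = instantiate (t ∷ []) (induction (x₀ ≐ Z ∨' x₀ ≐ S (P x₀)) 0
  (∨-intro₁ ≐-refl)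
  (∨-intro₂ (S-cong (≐-sym (P-suc x₀)))))

≢0⇒≐S : Γ ⊩ ¬' (t ≐ Z) → Γ ⊩ t ≐ S (P t)
≢0⇒≐S {t = t} t≢0 = ∨-cases (zero-or-suc t) (contradiction hyp₀ (⊩-weaken t≢0)) hyp₀

P-injective : Γ ⊩ ¬' (t ≐ Z) → Γ ⊩ ¬' (u ≐ Z) → Γ ⊩ P t ≐ P u → Γ ⊩ t ≐ u
P-injective t≢0 u≢0 Pt≐Pu = ≐-trans (≢0⇒≐S t≢0) (≐-trans (S-cong Pt≐Pu) (≐-sym (≢0⇒≐S u≢0)))

+-identityˡ : ∀ t → Γ ⊩ Z ⊹ t ≐ t
+-identityˡ t = instantiate (t ∷ []) (induction (Z ⊹ x₀ ≐ x₀) 0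
  (+-identityʳ Z)
  (Z ⊹ S x₀ ≐⟨ +-suc Z x₀ ⟩ S-cong hyp₀))

+-sucˡ : ∀ t u → Γ ⊩ S t ⊹ u ≐ S (t ⊹ u)
+-sucˡ t u = instantiate (t ∷ u ∷ []) (induction (S x₀ ⊹ x₁ ≐ S (x₀ ⊹ x₁)) 1
  (S x₀ ⊹ Z ≐⟨ +-identityʳ (S x₀) ⟩ S-cong (≐-sym (+-identityʳ x₀)))
  (S x₀ ⊹ S x₁ ≐⟨ +-suc (S x₀) x₁ ⟩ S (S x₀ ⊹ x₁) ≐⟨ S-cong hyp₀ ⟩
   S-cong (≐-sym (+-suc x₀ x₁))))

+-comm : ∀ t u → Γ ⊩ t ⊹ u ≐ u ⊹ t
+-comm t u = instantiate (t ∷ u ∷ []) (induction (x₀ ⊹ x₁ ≐ x₁ ⊹ x₀) 1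
  (x₀ ⊹ Z ≐⟨ +-identityʳ x₀ ⟩ ≐-sym (+-identityˡ x₀))
  (x₀ ⊹ S x₁ ≐⟨ +-suc x₀ x₁ ⟩ S (x₀ ⊹ x₁) ≐⟨ S-cong hyp₀ ⟩ ≐-sym (+-sucˡ x₁ x₀)))

+-assoc : ∀ t u w → Γ ⊩ (t ⊹ u) ⊹ w ≐ t ⊹ (u ⊹ w)
+-assoc t u w = instantiate (t ∷ u ∷ w ∷ []) (induction ((x₀ ⊹ x₁) ⊹ x₂ ≐ x₀ ⊹ (x₁ ⊹ x₂)) 2
  ((x₀ ⊹ x₁) ⊹ Z ≐⟨ +-identityʳ _ ⟩ ⊹-cong ≐-refl (≐-sym (+-identityʳ x₁)))
  ((x₀ ⊹ x₁) ⊹ S x₂          ≐⟨ +-suc _ _ ⟩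
   S ((x₀ ⊹ x₁) ⊹ x₂)         ≐⟨ S-cong hyp₀ ⟩
   S (x₀ ⊹ (x₁ ⊹ x₂))         ≐⟨ ≐-sym (+-suc _ _) ⟩
   ⊹-cong ≐-refl (≐-sym (+-suc x₁ x₂))))

+-cancelˡ : Γ ⊩ t ⊹ u ≐ t ⊹ w → Γ ⊩ u ≐ w
+-cancelˡ {t = t} {u = u} {w = w} = ⊩-mp (instantiate (t ∷ u ∷ w ∷ [])
  (induction (x₀ ⊹ x₁ ≐ x₀ ⊹ x₂ ⇒ x₁ ≐ x₂) 0
    (⊩-intro (≐-resp (+-identityˡ x₁) (+-identityˡ x₂) hyp₀))
    (⊩-intro (⊩-mp hyp₁ (S-injective (≐-resp (+-sucˡ x₀ x₁) (+-sucˡ x₀ x₂) hyp₀))))))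

∸-suc-suc : ∀ t u → Γ ⊩ S t ∸' S u ≐ t ∸' u
∸-suc-suc t u = instantiate (t ∷ u ∷ []) (induction (S x₀ ∸' S x₁ ≐ x₀ ∸' x₁) 1
  (S x₀ ∸' S Z ≐⟨ ∸-suc _ _ ⟩ P (S x₀ ∸' Z) ≐⟨ P-cong (∸-identityʳ _) ⟩
   P (S x₀) ≐⟨ P-suc x₀ ⟩
   ≐-sym (∸-identityʳ x₀))
  (S x₀ ∸' S (S x₁) ≐⟨ ∸-suc _ _ ⟩ P (S x₀ ∸' S x₁) ≐⟨ P-cong hyp₀ ⟩ ≐-sym (∸-suc x₀ x₁)))

∸-zeroˡ : ∀ t → Γ ⊩ Z ∸' t ≐ Z
∸-zeroˡ t = instantiate (t ∷ []) (induction (Z ∸' x₀ ≐ Z) 0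
  (∸-identityʳ Z)
  (Z ∸' S x₀ ≐⟨ ∸-suc _ _ ⟩ P (Z ∸' x₀) ≐⟨ P-cong hyp₀ ⟩ P-zero))

+-∸-cancel : ∀ t u → Γ ⊩ (t ⊹ u) ∸' t ≐ u
+-∸-cancel t u = instantiate (t ∷ u ∷ []) (induction ((x₀ ⊹ x₁) ∸' x₀ ≐ x₁) 0
  ((Z ⊹ x₁) ∸' Z ≐⟨ ∸-identityʳ _ ⟩ +-identityˡ x₁)
  ((S x₀ ⊹ x₁) ∸' S x₀ ≐⟨ ∸-cong (+-sucˡ _ _) ≐-refl ⟩
   S (x₀ ⊹ x₁) ∸' S x₀ ≐⟨ ∸-suc-suc _ _ ⟩
   hyp₀))

∸-self : ∀ t → Γ ⊩ t ∸' t ≐ Z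
∸-self t = t ∸' t ≐⟨ ∸-cong (≐-sym (+-identityʳ t)) ≐-refl ⟩ +-∸-cancel t Z

m≤m⊹n : ∀ t u → Γ ⊩ t ≤' (t ⊹ u)
m≤m⊹n t u = instantiate (t ∷ u ∷ []) (induction (x₀ ∸' (x₀ ⊹ x₁) ≐ Z) 1
  (x₀ ∸' (x₀ ⊹ Z) ≐⟨ ∸-cong ≐-refl (+-identityʳ x₀) ⟩ ∸-self x₀)
  (x₀ ∸' (x₀ ⊹ S x₁) ≐⟨ ∸-cong ≐-refl (+-suc _ _) ⟩ x₀ ∸' S (x₀ ⊹ x₁) ≐⟨ ∸-suc _ _ ⟩
   P (x₀ ∸' (x₀ ⊹ x₁)) ≐⟨ P-cong hyp₀ ⟩ P-zero))

≐⊹⇒≐⊹∸ : Γ ⊩ u ≐ t ⊹ d → Γ ⊩ u ≐ t ⊹ (u ∸' t)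
≐⊹⇒≐⊹∸ {u = u} {t = t} {d = d} u≐t⊹d =
  u                    ≐⟨ u≐t⊹d ⟩
  t ⊹ d                ≐⟨ ⊹-cong ≐-refl (≐-sym (+-∸-cancel t d)) ⟩
  t ⊹ ((t ⊹ d) ∸' t)   ≐⟨ ⊹-cong ≐-refl (∸-cong (≐-sym u≐t⊹d) ≐-refl) ⟩
  t ⊹ (u ∸' t) ∎

∸-total : ∀ t u → Γ ⊩ u ≐ t ⊹ (u ∸' t) ∨' t ≐ u ⊹ (t ∸' u)
∸-total t u = instantiate (t ∷ u ∷ []) (induction total 1
  (∨-intro₂ (≐-sym (Z ⊹ (x₀ ∸' Z) ≐⟨ +-identityˡ _ ⟩ ∸-identityʳ x₀)))
  (∨-cases hyp₀ below above))
  where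
  total : Fm ℕ
  total = x₁ ≐ x₀ ⊹ (x₁ ∸' x₀) ∨' x₀ ≐ x₁ ⊹ (x₀ ∸' x₁)
  total-suc : Fm ℕ
  total-suc = S x₁ ≐ x₀ ⊹ (S x₁ ∸' x₀) ∨' x₀ ≐ S x₁ ⊹ (x₀ ∸' S x₁)
  below : x₁ ≐ x₀ ⊹ (x₁ ∸' x₀) ∷ total ∷ [] ⊩ total-suc
  below = ∨-intro₁ (≐⊹⇒≐⊹∸ (S x₁ ≐⟨ S-cong hyp₀ ⟩ ≐-sym (+-suc x₀ _)))
  above : x₀ ≐ x₁ ⊹ (x₀ ∸' x₁) ∷ total ∷ [] ⊩ total-suc
  above = ∨-cases (zero-or-suc (x₀ ∸' x₁))
    (∨-intro₁ (≐⊹⇒≐⊹∸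
      (S x₁ ≐⟨ S-cong (≐-sym (x₀ ≐⟨ hyp₁ ⟩ x₁ ⊹ (x₀ ∸' x₁) ≐⟨ ⊹-cong ≐-refl hyp₀ ⟩
                              +-identityʳ x₁)) ⟩
       S x₀ ≐⟨ S-cong (≐-sym (+-identityʳ x₀)) ⟩ ≐-sym (+-suc x₀ Z))))
    (∨-intro₂ (≐⊹⇒≐⊹∸
      (x₀ ≐⟨ hyp₁ ⟩ x₁ ⊹ (x₀ ∸' x₁) ≐⟨ ⊹-cong ≐-refl hyp₀ ⟩
       x₁ ⊹ S (P (x₀ ∸' x₁)) ≐⟨ +-suc _ _ ⟩
       ≐-sym (+-sucˡ x₁ _))))

≤-split : Γ ⊩ t ≤' u → Γ ⊩ u ≐ t ⊹ (u ∸' t)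
≤-split {t = t} {u = u} t≤u = ∨-cases (∸-total t u) hyp₀ (≐⊹⇒≐⊹∸ {d = Z}
  (u ≐⟨ ≐-sym (+-identityʳ u) ⟩ u ⊹ Z ≐⟨ ⊹-cong ≐-refl (≐-sym (⊩-weaken t≤u)) ⟩
   u ⊹ (t ∸' u) ≐⟨ ≐-sym hyp₀ ⟩ ≐-sym (+-identityʳ t)))

≰-split : Γ ⊩ ¬' (t ≤' u) → Γ ⊩ t ≐ u ⊹ (t ∸' u)
≰-split {t = t} {u = u} t≰u = ∨-cases (∸-total t u)
  (contradiction (t ∸' u ≐⟨ ∸-cong ≐-refl hyp₀ ⟩ m≤m⊹n t _) (⊩-weaken t≰u))
  hyp₀

≤-intro : Γ ⊩ u ≐ t ⊹ d → Γ ⊩ t ≤' u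
≤-intro {t = t} {d = d} u≐t⊹d = t ∸' _ ≐⟨ ∸-cong ≐-refl u≐t⊹d ⟩ m≤m⊹n t d

≤-reflexive : Γ ⊩ t ≐ u → Γ ⊩ t ≤' u
≤-reflexive {t = t} t≐u = t ∸' _ ≐⟨ ∸-cong ≐-refl (≐-sym t≐u) ⟩ ∸-self t

≤-resp : Γ ⊩ t ≐ t′ → Γ ⊩ u ≐ u′ → Γ ⊩ t ≤' u → Γ ⊩ t′ ≤' u′
≤-resp t≐t′ u≐u′ = ≐-resp (∸-cong t≐t′ u≐u′) ≐-refl

≤-trans : Γ ⊩ t ≤' u → Γ ⊩ u ≤' w → Γ ⊩ t ≤' w
≤-trans {t = t} {u = u} {w = w} t≤u u≤w = ≤-intro
  (w ≐⟨ ≤-split u≤w ⟩ u ⊹ (w ∸' u) ≐⟨ ⊹-cong (≤-split t≤u) ≐-refl ⟩ +-assoc t (u ∸' t) (w ∸' u))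

≤-antisym : Γ ⊩ t ≤' u → Γ ⊩ u ≤' t → Γ ⊩ t ≐ u
≤-antisym {t = t} {u = u} t≤u u≤t =
  ≐-sym (u ≐⟨ ≤-split t≤u ⟩ t ⊹ (u ∸' t) ≐⟨ ⊹-cong ≐-refl u≤t ⟩ +-identityʳ t)

n≤0⇒n≐0 : Γ ⊩ t ≤' Z → Γ ⊩ t ≐ Z
n≤0⇒n≐0 = ≐-resp (∸-identityʳ _) ≐-refl

z≤n : ∀ t → Γ ⊩ Z ≤' t
z≤n = ∸-zeroˡ

s≤s : Γ ⊩ t ≤' u → Γ ⊩ S t ≤' S u
s≤s {t = t} {u = u} t≤u = S t ∸' S u ≐⟨ ∸-suc-suc t u ⟩ t≤u

n≤1+n : ∀ t → Γ ⊩ t ≤' S t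
n≤1+n t = ≤-intro {d = S Z} (S t ≐⟨ S-cong (≐-sym (+-identityʳ t)) ⟩ ≐-sym (+-suc t Z))

m≤n⊹m : ∀ t u → Γ ⊩ t ≤' (u ⊹ t)
m≤n⊹m t u = ≤-intro (+-comm u t)

≐⊹S⇒S≤ : Γ ⊩ u ≐ t ⊹ S d → Γ ⊩ S t ≤' u
≐⊹S⇒S≤ {u = u} {t = t} {d = d} u≐t⊹Sd =
  ≤-intro (u ≐⟨ u≐t⊹Sd ⟩ t ⊹ S d ≐⟨ +-suc t d ⟩ ≐-sym (+-sucˡ t d))

≢⊹S : ∀ t d → Γ ⊩ ¬' (t ≐ t ⊹ S d)
≢⊹S t d = ¬-intro (S≢0 (≐-sym (+-cancelˡ (t ⊹ Z ≐⟨ +-identityʳ t ⟩ hyp₀))))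

S≤⇒< : Γ ⊩ S t ≤' u → Γ ⊩ t <' u
S≤⇒< {Γ = Γ} {t = t} {u = u} St≤u =
  ∧-intro (≤-intro u≐t⊹S) (¬-intro (contradiction (≐-trans hyp₀ (⊩-weaken u≐t⊹S)) (≢⊹S t _)))
  where
  u≐t⊹S : Γ ⊩ u ≐ t ⊹ S (u ∸' S t)
  u≐t⊹S = u ≐⟨ ≤-split St≤u ⟩ S t ⊹ (u ∸' S t) ≐⟨ +-sucˡ _ _ ⟩ ≐-sym (+-suc _ _)

<⇒S≤ : Γ ⊩ t <' u → Γ ⊩ S t ≤' u
<⇒S≤ {Γ = Γ} {t = t} {u = u} t<u = ∨-cases (zero-or-suc (u ∸' t))
  (contradiction (≐-sym (u ≐⟨ ≤-split t≤u ⟩ t ⊹ (u ∸' t) ≐⟨ ⊹-cong ≐-refl hyp₀ ⟩ +-identityʳ t))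
                 (∧-proj₂ (⊩-weaken t<u)))
  (≐⊹S⇒S≤ (u ≐⟨ ≤-split t≤u ⟩ ⊹-cong ≐-refl hyp₀))
  where
  t≤u : ∀ {φ} → φ ∷ Γ ⊩ t ≤' u
  t≤u = ∧-proj₁ (⊩-weaken t<u)

≰⇒> : Γ ⊩ ¬' (t ≤' u) → Γ ⊩ u <' t
≰⇒> {t = t} {u = u} t≰u = S≤⇒< (∨-cases (zero-or-suc (t ∸' u))
  (contradiction hyp₀ (⊩-weaken t≰u))
  (≐⊹S⇒S≤ (t ≐⟨ ≰-split (⊩-weaken t≰u) ⟩ ⊹-cong ≐-refl hyp₀)))

<-resp : Γ ⊩ t ≐ t′ → Γ ⊩ u ≐ u′ → Γ ⊩ t <' u → Γ ⊩ t′ <' u′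
<-resp t≐t′ u≐u′ t<u = S≤⇒< (≤-resp (S-cong t≐t′) u≐u′ (<⇒S≤ t<u))

<-irrefl : Γ ⊩ t <' t → Γ ⊩ φ
<-irrefl t<t = contradiction ≐-refl (∧-proj₂ t<t)

≮∧≯⇒≐ : Γ ⊩ ¬' (t <' u) → Γ ⊩ ¬' (u <' t) → Γ ⊩ t ≐ u
≮∧≯⇒≐ {t = t} {u = u} t≮u u≮t = by-cases (t ≤' u)
  (by-cases (t ≐ u) hyp₀ (contradiction (∧-intro hyp₁ hyp₀) (⊩-weaken (⊩-weaken t≮u))))
  (contradiction (≰⇒> hyp₀) (⊩-weaken u≮t))

<-≤-trans : Γ ⊩ t <' u → Γ ⊩ u ≤' w → Γ ⊩ t <' w
<-≤-trans t<u u≤w = S≤⇒< (≤-trans (<⇒S≤ t<u) u≤w)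

≤-<-trans : Γ ⊩ t ≤' u → Γ ⊩ u <' w → Γ ⊩ t <' w
≤-<-trans t≤u u<w = S≤⇒< (≤-trans (s≤s t≤u) (<⇒S≤ u<w))

⊹-monoʳ-≤ : ∀ w → Γ ⊩ t ≤' u → Γ ⊩ (w ⊹ t) ≤' (w ⊹ u)
⊹-monoʳ-≤ {t = t} {u = u} w t≤u =
  ≤-intro (w ⊹ u ≐⟨ ⊹-cong ≐-refl (≤-split t≤u) ⟩ ≐-sym (+-assoc w t (u ∸' t)))

⊹-monoˡ-≤ : ∀ w → Γ ⊩ t ≤' u → Γ ⊩ (t ⊹ w) ≤' (u ⊹ w)
⊹-monoˡ-≤ {t = t} {u = u} w t≤u = ≤-resp (+-comm w t) (+-comm w u) (⊹-monoʳ-≤ w t≤u)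

⊹-monoʳ-< : ∀ w → Γ ⊩ t <' u → Γ ⊩ (w ⊹ t) <' (w ⊹ u)
⊹-monoʳ-< {t = t} w t<u =
  S≤⇒< (≤-trans (≤-reflexive (≐-sym (+-suc w t))) (⊹-monoʳ-≤ w (<⇒S≤ t<u)))

⊹-cancelˡ-≤ : Γ ⊩ (w ⊹ t) ≤' (w ⊹ u) → Γ ⊩ t ≤' u
⊹-cancelˡ-≤ w⊹t≤w⊹u = ≤-intro (+-cancelˡ (≐-trans (≤-split w⊹t≤w⊹u) (+-assoc _ _ _)))

⊹-cancelˡ-< : Γ ⊩ (w ⊹ t) <' (w ⊹ u) → Γ ⊩ t <' u
⊹-cancelˡ-< {w = w} {t = t} w⊹t<w⊹u =
  S≤⇒< (⊹-cancelˡ-≤ (≤-trans (≤-reflexive (+-suc w t)) (<⇒S≤ w⊹t<w⊹u)))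

n<n⊹n : Γ ⊩ S Z ≤' t → Γ ⊩ t <' (t ⊹ t)
n<n⊹n {t = t} 1≤t = <-resp (+-identityʳ t) ≐-refl (⊹-monoʳ-< t (S≤⇒< 1≤t))

·-identityʳ : ∀ t → Γ ⊩ t · S Z ≐ t
·-identityʳ t = t · S Z ≐⟨ ·-suc t Z ⟩ t ⊹ (t · Z) ≐⟨ ⊹-cong ≐-refl (·-zero t) ⟩ +-identityʳ t

·-distribˡ-⊹ : ∀ t u w → Γ ⊩ t · (u ⊹ w) ≐ (t · u) ⊹ (t · w)
·-distribˡ-⊹ t u w = instantiate (t ∷ u ∷ w ∷ [])
  (induction (x₀ · (x₁ ⊹ x₂) ≐ (x₀ · x₁) ⊹ (x₀ · x₂)) 2
  (x₀ · (x₁ ⊹ Z) ≐⟨ ·-cong ≐-refl (+-identityʳ x₁) ⟩ x₀ · x₁ ≐⟨ ≐-sym (+-identityʳ _) ⟩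
   ⊹-cong ≐-refl (≐-sym (·-zero x₀)))
  (x₀ · (x₁ ⊹ S x₂)                   ≐⟨ ·-cong ≐-refl (+-suc x₁ x₂) ⟩
   x₀ · S (x₁ ⊹ x₂)                   ≐⟨ ·-suc _ _ ⟩
   x₀ ⊹ (x₀ · (x₁ ⊹ x₂))              ≐⟨ ⊹-cong ≐-refl hyp₀ ⟩
   x₀ ⊹ ((x₀ · x₁) ⊹ (x₀ · x₂))       ≐⟨ ≐-sym (+-assoc _ _ _) ⟩
   (x₀ ⊹ (x₀ · x₁)) ⊹ (x₀ · x₂)       ≐⟨ ⊹-cong (+-comm _ _) ≐-refl ⟩
   ((x₀ · x₁) ⊹ x₀) ⊹ (x₀ · x₂)       ≐⟨ +-assoc _ _ _ ⟩
   ⊹-cong ≐-refl (≐-sym (·-suc x₀ x₂))))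

·-monoʳ-≤ : ∀ s → Γ ⊩ u ≤' w → Γ ⊩ (s · u) ≤' (s · w)
·-monoʳ-≤ {u = u} {w = w} s u≤w =
  ≤-intro (s · w ≐⟨ ·-cong ≐-refl (≤-split u≤w) ⟩ ·-distribˡ-⊹ s u (w ∸' u))

n≤S·n : ∀ t u → Γ ⊩ u ≤' (S t · u)
n≤S·n t u = instantiate (t ∷ u ∷ []) (induction (x₁ ≤' (S x₀ · x₁)) 1
  (z≤n _)
  (≤-resp ≐-refl (≐-sym (S x₀ · S x₁ ≐⟨ ·-suc _ _ ⟩ +-sucˡ _ _))
    (s≤s (≤-trans hyp₀ (m≤n⊹m _ x₀)))))

2·n≐n⊹n : ∀ t → Γ ⊩ two · t ≐ t ⊹ t
2·n≐n⊹n t = instantiate (t ∷ []) (induction (two · x₀ ≐ x₀ ⊹ x₀) 0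
  (two · Z ≐⟨ ·-zero _ ⟩ ≐-sym (+-identityʳ Z))
  (two · S x₀              ≐⟨ ·-suc _ _ ⟩
   two ⊹ (two · x₀)        ≐⟨ ⊹-cong ≐-refl hyp₀ ⟩
   two ⊹ (x₀ ⊹ x₀)         ≐⟨ +-sucˡ _ _ ⟩
   S (S Z ⊹ (x₀ ⊹ x₀))     ≐⟨ S-cong (+-sucˡ _ _) ⟩
   S (S (Z ⊹ (x₀ ⊹ x₀)))   ≐⟨ S-cong (S-cong (+-identityˡ _)) ⟩
   ≐-sym (S x₀ ⊹ S x₀ ≐⟨ +-suc _ _ ⟩ S-cong (+-sucˡ _ _))))

2↑-suc : ∀ t → Γ ⊩ two ↑ S t ≐ (two ↑ t) ⊹ (two ↑ t)
2↑-suc t = two ↑ S t ≐⟨ ↑-suc _ _ ⟩ 2·n≐n⊹n _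

2↑-monoʳ-≤ : Γ ⊩ t ≤' u → Γ ⊩ (two ↑ t) ≤' (two ↑ u)
2↑-monoʳ-≤ {t = t} {u = u} t≤u =
  ≤-resp ≐-refl (↑-cong ≐-refl (≐-sym (≤-split t≤u))) (instantiate (t ∷ u ∸' t ∷ []) closed)
  where
  closed : ⊢ (two ↑ x₀) ≤' (two ↑ (x₀ ⊹ x₁))
  closed = induction ((two ↑ x₀) ≤' (two ↑ (x₀ ⊹ x₁))) 1
    (≤-reflexive (↑-cong ≐-refl (≐-sym (+-identityʳ x₀))))
    (≤-resp ≐-refl (≐-sym (two ↑ (x₀ ⊹ S x₁) ≐⟨ ↑-cong ≐-refl (+-suc _ _) ⟩ 2↑-suc _))
      (≤-trans hyp₀ (m≤m⊹n _ _)))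

1≤2↑n : ∀ t → Γ ⊩ S Z ≤' (two ↑ t)
1≤2↑n t = ≤-resp (↑-zero two) ≐-refl (2↑-monoʳ-≤ (z≤n t))

n≤2↑n : ∀ t → Γ ⊩ t ≤' (two ↑ t)
n≤2↑n t = instantiate (t ∷ []) (induction (x₀ ≤' (two ↑ x₀)) 0
  (z≤n _)
  (≤-resp (x₀ ⊹ S Z ≐⟨ +-suc _ _ ⟩ S-cong (+-identityʳ x₀)) (≐-sym (2↑-suc x₀))
    (≤-trans (⊹-monoˡ-≤ (S Z) hyp₀) (⊹-monoʳ-≤ (two ↑ x₀) (1≤2↑n x₀)))))

-- Characteristic functions

⇔-trans : Γ ⊩ φ ⇔ ψ → Γ ⊩ ψ ⇔ θ → Γ ⊩ φ ⇔ θ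
⇔-trans {φ = φ} {ψ = ψ} {θ = θ} = ⊩-map₂ (tautology (φ ∷ ψ ∷ θ ∷ [])
  ((atom 0 ⇔ₛ atom 1) ⇒ₛ (atom 1 ⇔ₛ atom 2) ⇒ₛ (atom 0 ⇔ₛ atom 2)))

¬-cong-⇔ : Γ ⊩ φ ⇔ ψ → Γ ⊩ (¬' φ) ⇔ (¬' ψ)
¬-cong-⇔ {φ = φ} {ψ = ψ} = ⊩-map (tautology (φ ∷ ψ ∷ [])
  ((atom 0 ⇔ₛ atom 1) ⇒ₛ (neg (atom 0) ⇔ₛ neg (atom 1))))

∨-cong-⇔ : ∀ {φ′ ψ′} → Γ ⊩ φ ⇔ ψ → Γ ⊩ φ′ ⇔ ψ′ → Γ ⊩ (φ ∨' φ′) ⇔ (ψ ∨' ψ′)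
∨-cong-⇔ {φ = φ} {ψ = ψ} {φ′ = φ′} {ψ′ = ψ′} = ⊩-map₂ (tautology (φ ∷ ψ ∷ φ′ ∷ ψ′ ∷ [])
  ((atom 0 ⇔ₛ atom 1) ⇒ₛ (atom 2 ⇔ₛ atom 3) ⇒ₛ ((atom 0 ∨ₛ atom 2) ⇔ₛ (atom 1 ∨ₛ atom 3))))

C-if-zero : Γ ⊩ s ≐ Z → Γ ⊩ C s t u ≐ t
C-if-zero {t = t} {u = u} s≐0 = ≐-trans (C-cong s≐0 ≐-refl ≐-refl) (C-zero t u)

C-if-nonzero : Γ ⊩ ¬' (s ≐ Z) → Γ ⊩ C s t u ≐ u
C-if-nonzero {t = t} {u = u} s≢0 = ≐-trans (C-cong (≢0⇒≐S s≢0) ≐-refl ≐-refl) (C-suc _ t u)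

=̇-char : ∀ s → Γ ⊩ (C s Z (S Z) ≐ Z) ⇔ (s ≐ Z)
=̇-char s = by-cases (s ≐ Z)
  (⇔-intro (⊩-weaken hyp₀) (C-if-zero hyp₁))
  (⇔-intro (S≢0 (≐-trans (≐-sym (C-if-nonzero hyp₁)) hyp₀)) (contradiction hyp₀ hyp₁))

¬̇-char : ∀ s → Γ ⊩ (C s (S Z) Z ≐ Z) ⇔ (¬' (s ≐ Z))
¬̇-char s = by-cases (s ≐ Z)
  (⇔-intro (S≢0 (≐-trans (≐-sym (C-if-zero hyp₁)) hyp₀)) (contradiction hyp₁ hyp₀))
  (⇔-intro (⊩-weaken hyp₀) (C-if-nonzero hyp₁))

∨̇-char : ∀ s s′ → Γ ⊩ (C s Z (C s′ Z (S Z)) ≐ Z) ⇔ (s ≐ Z ∨' s′ ≐ Z)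
∨̇-char s s′ = by-cases (s ≐ Z)
  (⇔-intro (∨-intro₁ hyp₁) (C-if-zero hyp₁))
  (by-cases (s′ ≐ Z)
    (⇔-intro (∨-intro₂ hyp₁) (≐-trans (C-if-nonzero hyp₂) (C-if-zero hyp₁)))
    (⇔-intro (S≢0 (≐-trans (≐-sym (≐-trans (C-if-nonzero hyp₂) (C-if-nonzero hyp₁))) hyp₀))
             (∨-cases hyp₀ (contradiction hyp₀ hyp₃) (contradiction hyp₀ hyp₂))))

m⊹n≐0⇒n≐0 : Γ ⊩ t ⊹ u ≐ Z → Γ ⊩ u ≐ Z
m⊹n≐0⇒n≐0 {t = t} {u = u} t⊹u≐0 = ∨-cases (zero-or-suc u) hyp₀
  (S≢0 (≐-trans (≐-sym (t ⊹ u ≐⟨ ⊹-cong ≐-refl hyp₀ ⟩ +-suc t (P u))) (⊩-weaken t⊹u≐0)))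

Eq-char : ∀ t u → Γ ⊩ (Eq t u ≐ Z) ⇔ (t ≐ u)
Eq-char t u = ⇔-intro
  (≤-antisym (m⊹n≐0⇒n≐0 (≐-trans (+-comm _ _) hyp₀)) (m⊹n≐0⇒n≐0 hyp₀))
  ((t ∸' u) ⊹ (u ∸' t) ≐⟨ ⊹-cong (∸-cong ≐-refl (≐-sym hyp₀)) (∸-cong ≐-refl hyp₀) ⟩
   (t ∸' t) ⊹ (u ∸' u) ≐⟨ ⊹-cong (∸-self _) (∸-self _) ⟩
   +-identityʳ Z)

χ-char : ∀ φ → Γ ⊩ (χ φ ≐ Z) ⇔ φ
χ-char (t ≐ u)  = ⇔-trans (=̇-char (Eq t u)) (Eq-char t u)
χ-char (¬' φ)   = ⇔-trans (¬̇-char (χ φ)) (¬-cong-⇔ (χ-char φ))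
χ-char (φ ∨' ψ) = ⇔-trans (∨̇-char (χ φ) (χ ψ)) (∨-cong-⇔ (χ-char φ) (χ-char ψ))

if-true : Γ ⊩ φ → Γ ⊩ C (χ φ) t u ≐ t
if-true {φ = φ} p = C-if-zero (⇔-from (χ-char φ) p)

if-false : Γ ⊩ ¬' φ → Γ ⊩ C (χ φ) t u ≐ u
if-false {φ = φ} ¬p = C-if-nonzero (¬-intro (contradiction (⇔-to (χ-char φ) hyp₀) (⊩-weaken ¬p)))

-- Bounded minimisation

module Minimisation (B : Fm (Fin 2)) where

  B-at : ∀ {V : Set} → Tm V → Tm V → Fin 2 → Tm V
  B-at q y fz      = q
  B-at q y (fs fz) = y

  -- B with q for its bound variable 0 and y for its parameter 1.
  B[_,_] : ∀ {V : Set} → Tm V → Tm V → Fm V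
  B[ q , y ] = substF (B-at q y) B

  μ : Tm ℕ → Tm ℕ → Tm ℕ
  μ y b = app (muF B) (y ∷ b ∷ [])

  B[]-subst : ∀ {V W : Set} (σ : V → Tm W) q y → substF σ B[ q , y ] ≡ B[ substT σ q , substT σ y ]
  B[]-subst σ q y = trans (substF-∘ σ (B-at q y) B) (substF-cong (λ { fz → refl ; (fs fz) → refl }) B)

  χB[]-subst : ∀ (σ : ℕ → Tm ℕ) q y → substT σ (χ B[ q , y ]) ≡ χ B[ substT σ q , substT σ y ]
  χB[]-subst σ q y = trans (χ-substF σ B[ q , y ]) (cong χ (B[]-subst σ q y))

  -- The defining equations of muF B substitute into B by substitutions local
  -- to muF, so these lemmas quantify over every substitution agreeing with them.
  zero-case : ∀ (σ : Fin 2 → Tm (Fin 1)) → σ fz ≡ Z → σ (fs fz) ≡ var fz →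
    substT (var ∘ toℕ) (C (χ (substF σ B)) Z (S Z)) ≡ C (χ B[ Z , x₀ ]) Z (S Z)
  zero-case σ σ₀ σ₁ = cong (λ c → C c Z (S Z))
    (trans (χ-substF _ (substF σ B)) (cong χ (trans (substF-∘ _ σ B) (substF-cong agree B))))
    where
    agree : ∀ v → substT (var ∘ toℕ) (σ v) ≡ B-at Z x₀ v
    agree fz      rewrite σ₀ = refl
    agree (fs fz) rewrite σ₁ = refl

  suc-case : ∀ (σ : Fin 3 → Tm ℕ) (τ : Fin 2 → Tm (Fin 3)) →
    σ (fs fz) ≡ x₁ → σ (fs (fs fz)) ≡ x₀ → τ fz ≡ S (var (fs fz)) → τ (fs fz) ≡ var (fs (fs fz)) →
    substT σ (χ (substF τ B)) ≡ χ B[ S x₁ , x₀ ]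
  suc-case σ τ σ₁ σ₂ τ₀ τ₁ =
    trans (χ-substF σ (substF τ B)) (cong χ (trans (substF-∘ σ τ B) (substF-cong agree B)))
    where
    agree : ∀ v → substT σ (τ v) ≡ B-at (S x₁) x₀ v
    agree fz      rewrite τ₀ | σ₁ = refl
    agree (fs fz) rewrite τ₁ | σ₂ = refl

  μ-zero : ∀ y → Γ ⊩ μ y Z ≐ C (χ B[ Z , y ]) Z (S Z)
  μ-zero y = subst (λ c → _ ⊩ μ y Z ≐ C c Z (S Z)) (χB[]-subst (arguments (y ∷ [])) Z x₀)
    (instantiate (y ∷ []) (subst (λ rhs → ⊢ μ x₀ Z ≐ rhs) (zero-case _ refl refl) (ax-def0 _ _)))

  μ-suc : ∀ y b → Γ ⊩ μ y (S b) ≐ C (χ (μ y b ≤' b)) (μ y b) (C (χ B[ S b , y ]) (S b) (S (S b)))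
  μ-suc y b = subst (λ c → _ ⊩ μ y (S b) ≐ C (χ (μ y b ≤' b)) (μ y b) (C c (S b) (S (S b))))
    (χB[]-subst (arguments (y ∷ b ∷ [])) (S x₁) x₀)
    (instantiate (y ∷ b ∷ [])
      (subst (λ c → ⊢ μ x₀ (S x₁) ≐ C (χ (μ x₀ x₁ ≤' x₁)) (μ x₀ x₁) (C c (S x₁) (S (S x₁))))
        (suc-case _ _ refl refl refl refl) (ax-defS _ _)))

  B-resp : ∀ {y} → Γ ⊩ t ≐ u → Γ ⊩ B[ t , y ] → Γ ⊩ B[ u , y ]
  B-resp {t = t} {u = u} {y = y} t≐u Bt = ⊩-mp (⊩-lift leibniz-B) (∧-intro t≐u Bt)
    where
    σ : ℕ → Tm ℕ
    σ = arguments (t ∷ u ∷ y ∷ [])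
    closed : ⊢ x₀ ≐ x₁ ∧' B[ x₀ , x₂ ] ⇒ B[ x₁ , x₂ ]
    closed = subst (λ ψ → ⊢ x₀ ≐ x₁ ∧' B[ x₀ , x₂ ] ⇒ ψ) (B[]-subst (sub1 0 x₁) x₀ x₂)
      (ax-leib 0 1 B[ x₀ , x₂ ])
    leibniz-B : ⊢ t ≐ u ∧' B[ t , y ] ⇒ B[ u , y ]
    leibniz-B = subst₂ (λ φ ψ → ⊢ t ≐ u ∧' φ ⇒ ψ) (B[]-subst σ x₀ x₂) (B[]-subst σ x₁ x₂)
      (r-inst σ closed)

  Invariant : Tm ℕ → Tm ℕ → Tm ℕ → Fm ℕ
  Invariant y b q = (μ y b ≤' b ⇒ B[ μ y b , y ]) ∧' (q ≤' b ∧' B[ q , y ] ⇒ μ y b ≤' b)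

  Invariant-subst : ∀ (σ : ℕ → Tm ℕ) y b q →
    substF σ (Invariant y b q) ≡ Invariant (substT σ y) (substT σ b) (substT σ q)
  Invariant-subst σ y b q = cong₂
    (λ φ ψ → (μ (substT σ y) (substT σ b) ≤' substT σ b ⇒ φ) ∧'
             (substT σ q ≤' substT σ b ∧' ψ ⇒ μ (substT σ y) (substT σ b) ≤' substT σ b))
    (B[]-subst σ (μ y b) y) (B[]-subst σ q y)

  μ-invariant : ⊢ Invariant x₀ x₁ x₂
  μ-invariant = r-ind 1
    (subst ⊢_ (sym (Invariant-subst (sub1 1 Z) x₀ x₁ x₂)) (⊩⇒⊢ base))
    (subst (λ φ → ⊢ Invariant x₀ x₁ x₂ ⇒ φ) (sym (Invariant-subst (sub1 1 (S x₁)) x₀ x₁ x₂)) (proof step))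
    where
    base : [] ⊩ Invariant x₀ Z x₂
    base = ∧-intro
      (⊩-intro (by-cases B[ Z , x₀ ]
        (B-resp (≐-sym (n≤0⇒n≐0 hyp₁)) hyp₀)
        (S≢0 (≐-trans (≐-sym (≐-trans (μ-zero x₀) (if-false hyp₀))) (n≤0⇒n≐0 hyp₁)))))
      (⊩-intro (≤-reflexive (≐-trans (μ-zero x₀)
        (if-true (B-resp (n≤0⇒n≐0 (∧-proj₁ hyp₀)) (∧-proj₂ hyp₀))))))

    m m′ : Tm ℕ
    m  = μ x₀ x₁
    m′ = μ x₀ (S x₁)

    m′-if-≤ : ∀ {Δ} → Δ ⊩ m ≤' x₁ → Δ ⊩ m′ ≐ m
    m′-if-≤ m≤x₁ = ≐-trans (μ-suc x₀ x₁) (if-true m≤x₁)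

    m′-if-found : ∀ {Δ} → Δ ⊩ ¬' (m ≤' x₁) → Δ ⊩ B[ S x₁ , x₀ ] → Δ ⊩ m′ ≐ S x₁
    m′-if-found m≰x₁ found = ≐-trans (μ-suc x₀ x₁) (≐-trans (if-false m≰x₁) (if-true found))

    m′-if-none : ∀ {Δ} → Δ ⊩ ¬' (m ≤' x₁) → Δ ⊩ ¬' B[ S x₁ , x₀ ] → Δ ⊩ m′ ≐ S (S x₁)
    m′-if-none m≰x₁ none = ≐-trans (μ-suc x₀ x₁) (≐-trans (if-false m≰x₁) (if-false none))

    step : Invariant x₀ x₁ x₂ ∷ [] ⊩ Invariant x₀ (S x₁) x₂
    step = by-cases (m ≤' x₁)
      (∧-intro
        (⊩-intro (B-resp (≐-sym (m′-if-≤ hyp₁)) (⊩-mp (∧-proj₁ hyp₂) hyp₁)))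
        (⊩-intro (≤-resp (≐-sym (m′-if-≤ hyp₁)) ≐-refl (≤-trans hyp₁ (n≤1+n x₁)))))
      (by-cases B[ S x₁ , x₀ ]
        (∧-intro
          (⊩-intro (B-resp (≐-sym (m′-if-found hyp₂ hyp₁)) hyp₁))
          (⊩-intro (≤-reflexive (m′-if-found hyp₂ hyp₁))))
        (∧-intro
          (⊩-intro (<-irrefl (S≤⇒< (≤-resp (m′-if-none hyp₂ hyp₁) ≐-refl hyp₀))))
          (⊩-intro (by-cases (x₂ ≤' x₁)
            (contradiction (⊩-mp (∧-proj₂ hyp₄) (∧-intro hyp₀ (∧-proj₂ hyp₁))) hyp₃)
            (contradiction (B-resp (≤-antisym (∧-proj₁ hyp₁) (<⇒S≤ (≰⇒> hyp₀))) (∧-proj₂ hyp₁)) hyp₂)))))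

  μ-witness : ∀ {q b y} → Γ ⊩ q ≤' b → Γ ⊩ B[ q , y ] → Γ ⊩ B[ μ y b , y ]
  μ-witness {Γ = Γ} {q = q} {b = b} {y = y} q≤b Bq =
    ⊩-mp (∧-proj₁ invariant) (⊩-mp (∧-proj₂ invariant) (∧-intro q≤b Bq))
    where
    invariant : Γ ⊩ Invariant y b q
    invariant = subst (Γ ⊩_) (Invariant-subst (arguments (y ∷ b ∷ q ∷ [])) x₀ x₁ x₂)
      (instantiate (y ∷ b ∷ q ∷ []) μ-invariant)

-- The pairing function

-- lg t is ⌊log₂ (S t)⌋.
lgF : Fn 1
lgF = frec Z (C (χ ((two ↑ S (var fz)) ≤' S (S (var (fs fz))))) (S (var fz)) (var fz))

lg : Tm ℕ → Tm ℕ
lg t = app lgF (t ∷ [])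

lg-zero : Γ ⊩ lg Z ≐ Z
lg-zero = instantiate [] (ax-def0 _ _)

lg-suc : ∀ t → Γ ⊩ lg (S t) ≐ C (χ ((two ↑ S (lg t)) ≤' S (S t))) (S (lg t)) (lg t)
lg-suc t = instantiate (t ∷ []) (ax-defS _ _)

lg-spec : ∀ t → Γ ⊩ (two ↑ lg t) ≤' S t ∧' S t <' (two · (two ↑ lg t))
lg-spec t = instantiate (t ∷ []) (induction spec 0 base step)
  where
  spec : Fm ℕ
  spec = (two ↑ lg x₀) ≤' S x₀ ∧' S x₀ <' (two · (two ↑ lg x₀))
  2↑lg0 : [] ⊩ two ↑ lg Z ≐ S Z
  2↑lg0 = ≐-trans (↑-cong ≐-refl lg-zero) (↑-zero two)
  base : [] ⊩ (two ↑ lg Z) ≤' S Z ∧' S Z <' (two · (two ↑ lg Z))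
  base = ∧-intro (≤-reflexive 2↑lg0)
    (<-resp ≐-refl (≐-sym (≐-trans (·-cong ≐-refl 2↑lg0) (·-identityʳ two))) (S≤⇒< (≤-reflexive ≐-refl)))
  next : Tm ℕ
  next = two ↑ S (lg x₀)
  step : spec ∷ [] ⊩ (two ↑ lg (S x₀)) ≤' S (S x₀) ∧' S (S x₀) <' (two · (two ↑ lg (S x₀)))
  step = by-cases (next ≤' S (S x₀))
    (∧-intro (≤-resp (≐-sym (↑-cong ≐-refl lg-grows)) ≐-refl hyp₀)
      (<-resp ≐-refl (≐-sym (≐-trans (·-cong ≐-refl (↑-cong ≐-refl lg-grows)) (2·n≐n⊹n next)))
        (≤-<-trans (≤-resp ≐-refl (≐-sym (↑-suc two (lg x₀))) (<⇒S≤ (∧-proj₂ hyp₁)))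
          (n<n⊹n (1≤2↑n (S (lg x₀)))))))
    (∧-intro (≤-resp (≐-sym (↑-cong ≐-refl lg-stays)) ≐-refl (≤-trans (∧-proj₁ hyp₁) (n≤1+n _)))
      (<-resp ≐-refl (≐-trans (↑-suc two (lg x₀)) (·-cong ≐-refl (≐-sym (↑-cong ≐-refl lg-stays))))
        (≰⇒> hyp₀)))
    where
    lg-grows : next ≤' S (S x₀) ∷ spec ∷ [] ⊩ lg (S x₀) ≐ S (lg x₀)
    lg-grows = ≐-trans (lg-suc x₀) (if-true hyp₀)
    lg-stays : ¬' (next ≤' S (S x₀)) ∷ spec ∷ [] ⊩ lg (S x₀) ≐ lg x₀
    lg-stays = ≐-trans (lg-suc x₀) (if-false hyp₀)

module Log₂ = Minimisation (two ↑ var fz ≐ var (fs fz))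
module Qμ = Minimisation BQ

-- The first conjunct of BQ, isPow2 q, unfolds to Log₂.B[ Log₂.μ q q , q ].
Q-spec : ∀ t → Γ ⊩ Qμ.B[ Q t , t ]
Q-spec t = Qμ.μ-witness (∧-proj₁ (lg-spec t))
  (∧-intro (Log₂.μ-witness (n≤2↑n (lg t)) ≐-refl) (lg-spec t))

log₂Q : Tm ℕ → Tm ℕ
log₂Q t = Log₂.μ (Q t) (Q t)

2↑log₂Q≐Q : ∀ t → Γ ⊩ two ↑ log₂Q t ≐ Q t
2↑log₂Q≐Q t = ∧-proj₁ (Q-spec t)

S≐Q⊹R : ∀ t → Γ ⊩ S t ≐ Q t ⊹ R t
S≐Q⊹R t = ≤-split (∧-proj₁ (∧-proj₂ (Q-spec t)))

S<2·Q : ∀ t → Γ ⊩ S t <' (two · Q t)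
S<2·Q t = ∧-proj₂ (∧-proj₂ (Q-spec t))

R<Q : ∀ t → Γ ⊩ R t <' Q t
R<Q t = ⊹-cancelˡ-< (<-resp (S≐Q⊹R t) (2·n≐n⊹n (Q t)) (S<2·Q t))

Q≢0 : ∀ t → Γ ⊩ ¬' (Q t ≐ Z)
Q≢0 t = ¬-intro (S≢0 (n≤0⇒n≐0
  (<⇒S≤ (<-resp ≐-refl (two · Q t ≐⟨ ·-cong ≐-refl hyp₀ ⟩ ·-zero two) (S<2·Q t)))))

log₂Q-<⇒Q⊹Q≤Q : Γ ⊩ log₂Q t <' log₂Q u → Γ ⊩ (Q t ⊹ Q t) ≤' Q u
log₂Q-<⇒Q⊹Q≤Q {t = t} {u = u} log<log =
  ≤-resp (two ↑ S (log₂Q t) ≐⟨ 2↑-suc _ ⟩ ⊹-cong (2↑log₂Q≐Q t) (2↑log₂Q≐Q t)) (2↑log₂Q≐Q u)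
    (2↑-monoʳ-≤ (<⇒S≤ log<log))

[1+x]·a⊹r<[1+x]·a′⊹r′ : ∀ x {a r a′} r′ → Γ ⊩ r <' a → Γ ⊩ (a ⊹ a) ≤' a′ →
  Γ ⊩ ((S x · a) ⊹ r) <' ((S x · a′) ⊹ r′)
[1+x]·a⊹r<[1+x]·a′⊹r′ x {a} {r} {a′} r′ r<a a⊹a≤a′ =
  <-≤-trans (⊹-monoʳ-< (S x · a) r<a)
    (≤-trans (⊹-monoʳ-≤ (S x · a) (n≤S·n x a))
      (≤-trans (≤-resp (·-distribˡ-⊹ (S x) a a) ≐-refl (·-monoʳ-≤ (S x) a⊹a≤a′))
        (m≤m⊹n (S x · a′) r′)))

S·Q⊹R≢0 : ∀ x t → Γ ⊩ ¬' ((S x · Q t) ⊹ R t ≐ Z)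
S·Q⊹R≢0 x t = ¬-intro (S≢0 (≐-trans (≐-sym S·Q≐S) (m⊹n≐0⇒n≐0 (≐-trans (+-comm _ _) hyp₀))))
  where
  S·Q≐S : ∀ {Δ} → Δ ⊩ S x · Q t ≐ S (x ⊹ (S x · P (Q t)))
  S·Q≐S = S x · Q t ≐⟨ ·-cong ≐-refl (≢0⇒≐S (Q≢0 t)) ⟩ S x · S (P (Q t)) ≐⟨ ·-suc _ _ ⟩ +-sucˡ _ _

⊕-injectiveʳ : ∀ x → Γ ⊩ x ⊕ t ≐ x ⊕ u → Γ ⊩ t ≐ u
⊕-injectiveʳ {Γ = Γ} {t = t} {u = u} x x⊕t≐x⊕u =
  S-injective (S t ≐⟨ S≐Q⊹R t ⟩ Q t ⊹ R t ≐⟨ ⊹-cong Qt≐Qu Rt≐Ru ⟩ ≐-sym (S≐Q⊹R u))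
  where
  unfolded : Γ ⊩ (S x · Q t) ⊹ R t ≐ (S x · Q u) ⊹ R u
  unfolded = P-injective (S·Q⊹R≢0 x t) (S·Q⊹R≢0 x u) x⊕t≐x⊕u
  smaller-log-absurd : ∀ {Δ v w} → Δ ⊩ (S x · Q v) ⊹ R v ≐ (S x · Q w) ⊹ R w →
                       Δ ⊩ log₂Q v <' log₂Q w → Δ ⊩ ¬' (log₂Q v <' log₂Q w)
  smaller-log-absurd {w = w} eq log<log =
    <-irrefl (<-resp eq ≐-refl ([1+x]·a⊹r<[1+x]·a′⊹r′ x (R w) (R<Q _) (log₂Q-<⇒Q⊹Q≤Q log<log)))
  log-eq : Γ ⊩ log₂Q t ≐ log₂Q u
  log-eq = ≮∧≯⇒≐ (¬-intro (smaller-log-absurd (⊩-weaken unfolded) hyp₀))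
                 (¬-intro (smaller-log-absurd (⊩-weaken (≐-sym unfolded)) hyp₀))
  Qt≐Qu : Γ ⊩ Q t ≐ Q u
  Qt≐Qu = ≐-trans (≐-sym (2↑log₂Q≐Q t)) (≐-trans (↑-cong ≐-refl log-eq) (2↑log₂Q≐Q u))
  Rt≐Ru : Γ ⊩ R t ≐ R u
  Rt≐Ru = +-cancelˡ (≐-trans unfolded (⊹-cong (·-cong ≐-refl (≐-sym Qt≐Qu)) ≐-refl))

mainTheorem15 : ⊢ (var 0 ⊕ var 1 ≐ var 0 ⊕ var 2) ⇒ (var 1 ≐ var 2)
mainTheorem15 = ⊩⇒⊢ (⊩-intro (⊕-injectiveʳ (var 0) hyp₀))
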